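{- Let $\mathsf{Boxes}$ and $\mathsf{Inputs}$ be types, let $\mathsf{Arity} : \mathsf{Boxes} \to \mathsf{Type}$, let $\mathsf{Dom}(b,a)$ be a polynomial for each $b : \mathsf{Boxes}$ and $a : \mathsf{Arity}(b)$, let $\mathsf{Cod}(b)$ be a polynomial for each $b : \mathsf{Boxes}$, and let $\mathsf{inputs}(i)$ be a polynomial for each $i : \mathsf{Inputs}$. Let $p$ be a polynomial and let $W : \mathsf{Wiring}(p)$ be a wiring diagram with output interface $p$. Suppose that for each box $b : \mathsf{Boxes}$ we are given an implementation $$g_b : \mathsf{Cod}(b) \Rightarrow \mathsf{Free}\big(\mathsf{sum}\,(\mathsf{Arity}\,b)\,(\mathsf{Dom}\,b)\big).$$ Then there is an induced implementation $p \Rightarrow \mathsf{Free}\big(\mathsf{sum}\,\mathsf{Inputs}\,\mathsf{inputs}\big)$.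
   Context: Work in dependent type theory, with $\mathsf{Type}$ a universe of types. A polynomial is a pair $p=(A,B)$ with $A$ a type (positions) and $B : A \to \mathsf{Type}$ (directions). For a polynomial $(A,B)$ and a function $F : \mathsf{Type}\to\mathsf{Type}$, write $(A,B) \Rightarrow F$ for the type $\prod_{a:A} F(B(a))$. For a polynomial $p=(A,B)$ and type $C$, the free monad $\mathsf{Free}\,p\,C$ is the inductive type with constructors $\mathsf{return} : C \to \mathsf{Free}\,p\,C$ and $\mathsf{bind} : \prod_{a:A} (B(a) \to \mathsf{Free}\,p\,C) \to \mathsf{Free}\,p\,C$. An implementation of interface $p$ depending on interface $q$ is an element of $p \Rightarrow \mathsf{Free}\,q$. For a type $U$ and a family of polynomials $P(u)=(A_u,B_u)$, $u:U$, the sum is the polynomial $\mathsf{sum}\,U\,P = \big(\sum_{u:U} A_u,\ (u,x)\mapsto B_u(x)\big)$. Given the data $\mathsf{Boxes},\mathsf{Arity},\mathsf{Dom},\mathsf{Cod},\mathsf{Inputs},\mathsf{inputs}$ as in the claim, the type family of wiring diagrams $\mathsf{Wiring}(o)$, indexed by polynomials $o$, is inductively generated by: $\mathsf{wire}(i) : \mathsf{Wiring}(\mathsf{inputs}(i))$ for $i:\mathsf{Inputs}$; and $\mathsf{box}(b,f) : \mathsf{Wiring}(\mathsf{Cod}(b))$ for $b : \mathsf{Boxes}$ and $f : \prod_{a:\mathsf{Arity}(b)} \mathsf{Wiring}(\mathsf{Dom}(b,a))$. -}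

module Defs where

open import Data.Product using (Σ; _,_; proj₁; proj₂)

record Poly : Set₁ where
  constructor poly
  field
    Pos : Set
    Dir : Pos → Set
open Poly public

_⇒_ : Poly → (Set → Set) → Set
p ⇒ F = (a : Pos p) → F (Dir p a)

data Free (p : Poly) (C : Set) : Set where
  return : C → Free p C
  bind   : (a : Pos p) → (Dir p a → Free p C) → Free p C

sum : (U : Set) → (U → Poly) → Poly
sum U P = poly (Σ U (λ u → Pos (P u))) (λ ux → Dir (P (proj₁ ux)) (proj₂ ux))

data Wiring (Boxes : Set) (Arity : Boxes → Set)
            (Dom : (b : Boxes) → Arity b → Poly) (Cod : Boxes → Poly)
            (Inputs : Set) (inputs : Inputs → Poly) : Poly → Set₁ where
  wire : (i : Inputs) → Wiring Boxes Arity Dom Cod Inputs inputs (inputs i)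
  box  : (b : Boxes) →
         ((a : Arity b) → Wiring Boxes Arity Dom Cod Inputs inputs (Dom b a)) →
         Wiring Boxes Arity Dom Cod Inputs inputs (Cod b)

{-# OPTIONS --safe #-}
-- Implementations compose: substituting an implementation of q into a free
-- computation over q (the Kleisli extension of the free monad) gives one over r.
-- A diagram is then interpreted by recursion on its structure: a wire is the
-- generic operation of its input, and a box runs its implementation with each
-- call to an argument interface replaced by the interpretation of the
-- sub-diagram plugged into it.
module Submission where

open import Data.Product using (_,_)

open import Defs

infixl 1 _>>=_

_>>=_ : {p : Poly} {A B : Set} → Free p A → (A → Free p B) → Free p B
return x >>= k = k x
bind a f >>= k = bind a (λ d → f d >>= k)

generic : (p : Poly) → p ⇒ Free p
generic p a = bind a return

interpret : {q r : Poly} {C : Set} → q ⇒ Free r → Free q C → Free r C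
interpret h (return c) = return c
interpret h (bind a k) = h a >>= λ d → interpret h (k d)

infixr 9 _∘ᵢ_

_∘ᵢ_ : {p q r : Poly} → q ⇒ Free r → p ⇒ Free q → p ⇒ Free r
(h ∘ᵢ g) a = interpret h (g a)

inject : {U : Set} (P : U → Poly) (u : U) → P u ⇒ Free (sum U P)
inject P u a = generic (sum _ P) (u , a)

copair : {U : Set} {P : U → Poly} {r : Poly} →
         ((u : U) → P u ⇒ Free r) → sum U P ⇒ Free r
copair h (u , a) = h u a

module Semantics
    {Boxes Inputs : Set} {Arity : Boxes → Set}
    {Dom : (b : Boxes) → Arity b → Poly} {Cod : Boxes → Poly}
    {inputs : Inputs → Poly}
    (impl : (b : Boxes) → Cod b ⇒ Free (sum (Arity b) (Dom b)))
  where

  ⟦_⟧ : {o : Poly} → Wiring Boxes Arity Dom Cod Inputs inputs o →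
        o ⇒ Free (sum Inputs inputs)
  ⟦ wire i ⟧  = inject inputs i
  ⟦ box b f ⟧ = copair (λ a → ⟦ f a ⟧) ∘ᵢ impl b

theorem1 : (Boxes Inputs : Set) (Arity : Boxes → Set)
           (Dom : (b : Boxes) → Arity b → Poly) (Cod : Boxes → Poly)
           (inputs : Inputs → Poly) (p : Poly)
           (W : Wiring Boxes Arity Dom Cod Inputs inputs p) →
           ((b : Boxes) → Cod b ⇒ Free (sum (Arity b) (Dom b))) →
           p ⇒ Free (sum Inputs inputs)
theorem1 Boxes Inputs Arity Dom Cod inputs p W impl = Semantics.⟦_⟧ impl W
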